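{- The class of proper interval graphs is strictly contained in the class of exactly hittable interval graphs.
   Context: An interval representation of a graph $G=(V,E)$ is a family of intervals of consecutive integers $\{I(v)\}_{v\in V}$ with $uv\in E$ iff $I(u)\cap I(v)\ne\emptyset$ for distinct $u,v$. $G$ is a proper interval graph if it has an interval representation in which no interval is properly contained in another. An interval graph is exactly hittable if it has an interval representation admitting a set $T$ of integers with $|T\cap I(v)|=1$ for every $v$. -}

module Defs where

open import Level using (0ℓ)
open import Data.Nat using (ℕ)
open import Data.Fin using (Fin)
open import Data.Integer using (ℤ; _≤_)
open import Data.Product using (Σ; ∃; ∃-syntax; _×_; _,_)
open import Relation.Nullary using (¬_)
open import Relation.Binary.PropositionalEquality using (_≡_; _≢_)

record Graph (n : ℕ) : Set₁ where
  field
    Adj     : Fin n → Fin n → Set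
    symm    : ∀ {u v} → Adj u v → Adj v u
    irrefl  : ∀ {u} → ¬ Adj u u
open Graph public

record Interval : Set where
  constructor [_,_]⟨_⟩
  field
    lo  : ℤ
    hi  : ℤ
    lo≤hi : lo ≤ hi
open Interval public

_∈I_ : ℤ → Interval → Set
k ∈I I = (lo I ≤ k) × (k ≤ hi I)

Intersects : Interval → Interval → Set
Intersects I J = ∃[ k ] (k ∈I I × k ∈I J)

_⊆I_ : Interval → Interval → Set
I ⊆I J = ∀ k → k ∈I I → k ∈I J

_⊊I_ : Interval → Interval → Set
I ⊊I J = I ⊆I J × ∃[ k ] (k ∈I J × ¬ (k ∈I I))

IsIntervalRep : ∀ {n} → Graph n → (Fin n → Interval) → Set
IsIntervalRep G I =
  ∀ u v → u ≢ v → (Adj G u v → Intersects (I u) (I v))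
                × (Intersects (I u) (I v) → Adj G u v)

IsIntervalGraph : ∀ {n} → Graph n → Set
IsIntervalGraph {n} G = Σ (Fin n → Interval) (IsIntervalRep G)

IsProperRep : ∀ {n} → (Fin n → Interval) → Set
IsProperRep I = ∀ u v → ¬ (I u ⊊I I v)

IsProperIntervalGraph : ∀ {n} → Graph n → Set
IsProperIntervalGraph {n} G =
  Σ (Fin n → Interval) λ I → IsIntervalRep G I × IsProperRep I

ExactlyHits : ∀ {n} → (ℤ → Set) → (Fin n → Interval) → Set
ExactlyHits T I =
  ∀ v → ∃[ t ] ((T t × t ∈I I v) × (∀ t' → T t' → t' ∈I I v → t' ≡ t))

IsExactlyHittable : ∀ {n} → Graph n → Set₁
IsExactlyHittable {n} G =
  Σ (Fin n → Interval) λ I → IsIntervalRep G I × ∃[ T ] ExactlyHits T I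

-- A proper representation is exactly hit by the greedy set: take the least right endpoint t,
-- which lies in every interval starting at or before t, and recurse on the intervals starting
-- after t. A second chosen point lying in an interval I(v) that contains t would be the right
-- endpoint of an interval starting after t, hence properly inside I(v). Conversely the claw
-- K₁,₃ is exactly hittable, but in any representation its centre meets three pairwise disjoint
-- intervals and so properly contains the middle one.
module Submission where

open import Defs
open import Data.Nat using (ℕ)
open import Data.Product using (_×_; ∃-syntax)
open import Relation.Nullary using (¬_)

import Data.Nat as ℕ
open import Data.Nat.Induction using (<-wellFounded)
open import Data.Bool using (Bool; true; false; T; _xor_)
open import Data.Bool.Properties using (xor-same)
open import Data.Empty using (⊥)
open import Data.Fin using (Fin; zero; suc; _≟_)
open import Data.Fin.Properties using (all?)
open import Data.Integer using (ℤ; +_; _≤_; _<_; _≤?_; _<?_; _⊔_; +≤+)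
open import Data.Integer.Properties
  using (≤-refl; ≤-trans; <⇒≤; <⇒≱; ≰⇒>; ≮⇒≥; <-≤-trans; ≤-<-trans; ≤-totalOrder; i≤i⊔j; i≤j⊔i; ⊔-lub)
open import Data.List using (List; []; _∷_; length; filter; allFin)
open import Data.List.Properties using (filter-notAll)
open import Data.List.Extrema ≤-totalOrder using (argmin; argmin-sel; f[argmin]≤f[⊤]; f[argmin]≤f[xs])
open import Data.List.Membership.Propositional using (_∈_; lose)
open import Data.List.Membership.Propositional.Properties using (∈-filter⁺; ∈-filter⁻; ∈-allFin)
open import Data.List.Relation.Unary.All using (_∷_; lookup)
open import Data.List.Relation.Unary.Any using (here; there)
open import Data.Product using (_,_; proj₁; proj₂)
open import Data.Sum using (_⊎_; inj₁; inj₂; [_,_]′)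
open import Function using (_∘_)
open import Induction.WellFounded using (Acc; acc)
open import Relation.Nullary using (Dec; yes; no; contradiction)
open import Relation.Nullary.Decidable using (map′; T?; ¬?; _×-dec_; _→-dec_; from-yes)
open import Relation.Binary.PropositionalEquality using (_≡_; _≢_; refl; subst; sym)

Overlap : Interval → Interval → Set
Overlap I J = lo I ≤ hi J × lo J ≤ hi I

overlap⇒intersects : ∀ I J → Overlap I J → Intersects I J
overlap⇒intersects I J (loI≤hiJ , loJ≤hiI) =
  lo I ⊔ lo J , (i≤i⊔j _ _ , ⊔-lub (lo≤hi I) loJ≤hiI) , (i≤j⊔i _ _ , ⊔-lub loI≤hiJ (lo≤hi J))

intersects⇒overlap : ∀ I J → Intersects I J → Overlap I J
intersects⇒overlap _ _ (_ , (loI≤k , k≤hiI) , (loJ≤k , k≤hiJ)) =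
  ≤-trans loI≤k k≤hiJ , ≤-trans loJ≤k k≤hiI

intersects? : (I J : Interval) → Dec (Intersects I J)
intersects? I J =
  map′ (overlap⇒intersects I J) (intersects⇒overlap I J) ((lo I ≤? hi J) ×-dec (lo J ≤? hi I))

¬intersects⇒separated : ∀ I J → ¬ Intersects I J → hi I < lo J ⊎ hi J < lo I
¬intersects⇒separated I J I∩J≡∅ with lo J ≤? hi I | lo I ≤? hi J
... | no loJ≰hiI  | _           = inj₁ (≰⇒> loJ≰hiI)
... | _           | no loI≰hiJ  = inj₂ (≰⇒> loI≰hiJ)
... | yes loJ≤hiI | yes loI≤hiJ =
  contradiction (overlap⇒intersects I J (loI≤hiJ , loJ≤hiI)) I∩J≡∅

_∈I?_ : (k : ℤ) (I : Interval) → Dec (k ∈I I)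
k ∈I? I = (lo I ≤? k) ×-dec (k ≤? hi I)

lo<lo⇒hi≤hi⇒⊊I : ∀ I J → lo J < lo I → hi I ≤ hi J → I ⊊I J
lo<lo⇒hi≤hi⇒⊊I I J loJ<loI hiI≤hiJ =
  (λ _ (loI≤k , k≤hiI) → ≤-trans (<⇒≤ loJ<loI) loI≤k , ≤-trans k≤hiI hiI≤hiJ) ,
  lo J , (≤-refl , lo≤hi J) , λ (loI≤loJ , _) → <⇒≱ loJ<loI loI≤loJ

between⇒⊊I : ∀ A B C D → hi A < lo B → hi B < lo C →
             Intersects D A → Intersects D C → B ⊊I D
between⇒⊊I A B C D A<B B<C D∩A D∩C =
  lo<lo⇒hi≤hi⇒⊊I B D (≤-<-trans (proj₁ (intersects⇒overlap D A D∩A)) A<B)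
                     (<⇒≤ (<-≤-trans B<C (proj₂ (intersects⇒overlap D C D∩C))))

meets-three-disjoint⇒⊊I : ∀ A B C D →
  ¬ Intersects A B → ¬ Intersects B C → ¬ Intersects A C →
  Intersects D A → Intersects D B → Intersects D C →
  A ⊊I D ⊎ B ⊊I D ⊎ C ⊊I D
meets-three-disjoint⇒⊊I A B C D A∥B B∥C A∥C D∩A D∩B D∩C
  with ¬intersects⇒separated A B A∥B | ¬intersects⇒separated B C B∥C | ¬intersects⇒separated A C A∥C
... | inj₁ A<B | inj₁ B<C | _        = inj₂ (inj₁ (between⇒⊊I A B C D A<B B<C D∩A D∩C))
... | inj₂ B<A | inj₂ C<B | _        = inj₂ (inj₁ (between⇒⊊I C B A D C<B B<A D∩C D∩A))
... | inj₁ A<B | inj₂ C<B | inj₁ A<C = inj₂ (inj₂ (between⇒⊊I A C B D A<C C<B D∩A D∩B))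
... | inj₁ A<B | inj₂ C<B | inj₂ C<A = inj₁ (between⇒⊊I C A B D C<A A<B D∩C D∩B)
... | inj₂ B<A | inj₁ B<C | inj₁ A<C = inj₁ (between⇒⊊I B A C D B<A A<C D∩B D∩C)
... | inj₂ B<A | inj₁ B<C | inj₂ C<A = inj₂ (inj₂ (between⇒⊊I B C A D B<C C<A D∩B D∩A))

module GreedyHitting {A : Set} (I : A → Interval) (proper : ∀ u v → ¬ I u ⊊I I v) where

  HitsExactlyOnce : (ℤ → Set) → A → Set
  HitsExactlyOnce S v = ∃[ t ] ((S t × t ∈I I v) × (∀ t' → S t' → t' ∈I I v → t' ≡ t))

  RightEndpointsOf : List A → (ℤ → Set) → Set
  RightEndpointsOf L S = ∀ t → S t → ∃[ w ] (w ∈ L × t ≡ hi (I w))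

  GreedySolution : List A → Set₁
  GreedySolution L =
    ∃[ S ] ((∀ {v} → v ∈ L → HitsExactlyOnce S v) × RightEndpointsOf L S)

  least-right-endpoint : (x : A) (L : List A) →
    ∃[ m ] (m ∈ x ∷ L × (∀ {j} → j ∈ x ∷ L → hi (I m) ≤ hi (I j)))
  least-right-endpoint x L =
    m , m∈x∷L , lookup (f[argmin]≤f[⊤] {f = hi ∘ I} x L ∷ f[argmin]≤f[xs] x L)
    where
    m : A
    m = argmin (hi ∘ I) x L
    m∈x∷L : m ∈ x ∷ L
    m∈x∷L with argmin-sel (hi ∘ I) x L
    ... | inj₁ m≡x = here m≡x
    ... | inj₂ m∈L = there m∈L

  add-least-right-endpoint : ∀ {L m} → m ∈ L → (∀ {j} → j ∈ L → hi (I m) ≤ hi (I j)) →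
    GreedySolution (filter (λ j → hi (I m) <? lo (I j)) L) → GreedySolution L
  add-least-right-endpoint {L} {m} m∈L least (S' , hits' , ends') = S , hits , ends
    where
    t = hi (I m)
    later? = λ j → t <? lo (I j)

    S : ℤ → Set
    S s = s ≡ t ⊎ S' s

    ends : RightEndpointsOf L S
    ends _ (inj₁ refl) = m , m∈L , refl
    ends s (inj₂ s∈S') with ends' s s∈S'
    ... | w , w∈ , s≡hi = w , proj₁ (∈-filter⁻ later? {xs = L} w∈) , s≡hi

    no-later-point-in : ∀ {v} → lo (I v) ≤ t → ∀ s → S' s → ¬ s ∈I I v
    no-later-point-in {v} lo≤t s s∈S' (_ , s≤hi) with ends' s s∈S'
    ... | w , w∈ , refl =
      proper w v (lo<lo⇒hi≤hi⇒⊊I (I w) (I v) (≤-<-trans lo≤t (proj₂ (∈-filter⁻ later? {xs = L} w∈))) s≤hi)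

    hits : ∀ {v} → v ∈ L → HitsExactlyOnce S v
    hits {v} v∈L with later? v
    ... | yes t<lo with hits' (∈-filter⁺ later? v∈L t<lo)
    ...   | s , (s∈S' , s∈v) , unique = s , (inj₂ s∈S' , s∈v) , unique-in-S
      where
      unique-in-S : ∀ s' → S s' → s' ∈I I v → s' ≡ s
      unique-in-S _ (inj₁ refl) (lo≤t , _) = contradiction lo≤t (<⇒≱ t<lo)
      unique-in-S s' (inj₂ s'∈S') s'∈v = unique s' s'∈S' s'∈v
    hits {v} v∈L | no t≮lo = t , (inj₁ refl , (≮⇒≥ t≮lo , least v∈L)) , unique-in-S
      where
      unique-in-S : ∀ s → S s → s ∈I I v → s ≡ t
      unique-in-S _ (inj₁ s≡t) _ = s≡t
      unique-in-S s (inj₂ s∈S') s∈v = contradiction s∈v (no-later-point-in (≮⇒≥ t≮lo) s s∈S')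

  greedy : (L : List A) → Acc ℕ._<_ (length L) → GreedySolution L
  greedy [] _ = (λ _ → ⊥) , (λ ()) , (λ _ ())
  greedy (x ∷ L) (acc smaller) with least-right-endpoint x L
  ... | m , m∈ , least = add-least-right-endpoint m∈ least (greedy _ (smaller shorter))
    where
    shorter = filter-notAll (λ j → hi (I m) <? lo (I j)) (x ∷ L)
                (lose m∈ (λ hi<lo → <⇒≱ hi<lo (lo≤hi (I m))))

proper⇒exactlyHittable : ∀ {n} (G : Graph n) → IsProperIntervalGraph G → IsExactlyHittable G
proper⇒exactlyHittable {n} G (I , rep , proper) =
  let T , hits , _ = GreedyHitting.greedy I proper (allFin n) (<-wellFounded _)
  in I , rep , T , λ v → hits (∈-allFin v)

isIntervalRep? : ∀ {n} (G : Graph n) → (∀ u v → Dec (Adj G u v)) →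
                 (I : Fin n → Interval) → Dec (IsIntervalRep G I)
isIntervalRep? G adj? I = all? λ u → all? λ v →
  ¬? (u ≟ v) →-dec ((adj? u v →-dec intersects? (I u) (I v))
                     ×-dec (intersects? (I u) (I v) →-dec adj? u v))

hitExactlyOnce-fromCount : ∀ I (ts : List ℤ) → length (filter (_∈I? I) ts) ≡ 1 →
  ∃[ t ] ((t ∈ ts × t ∈I I) × (∀ t' → t' ∈ ts → t' ∈I I → t' ≡ t))
hitExactlyOnce-fromCount I ts count with filter (_∈I? I) ts in hits
hitExactlyOnce-fromCount I ts () | []
hitExactlyOnce-fromCount I ts () | _ ∷ _ ∷ _
hitExactlyOnce-fromCount I ts refl | t ∷ [] =
  t , ∈-filter⁻ (_∈I? I) (subst (t ∈_) (sym hits) (here refl)) ,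
  λ t' t'∈ts t'∈I → the-only (subst (t' ∈_) hits (∈-filter⁺ (_∈I? I) t'∈ts t'∈I))
  where
  the-only : ∀ {t'} → t' ∈ t ∷ [] → t' ≡ t
  the-only (here t'≡t) = t'≡t

isCentre : Fin 4 → Bool
isCentre zero    = true
isCentre (suc _) = false

claw : Graph 4
claw = record
  { Adj    = λ u v → T (isCentre u xor isCentre v)
  ; symm   = λ {u} {v} → subst T (xor-comm (isCentre u) (isCentre v))
  ; irrefl = λ {u} → subst T (xor-same (isCentre u))
  }
  where
  xor-comm : ∀ a b → a xor b ≡ b xor a
  xor-comm true  true  = refl
  xor-comm true  false = refl
  xor-comm false true  = refl
  xor-comm false false = refl

claw-not-proper : ¬ IsProperIntervalGraph claw
claw-not-proper (I , rep , proper) =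
  [ proper _ zero , [ proper _ zero , proper _ zero ]′ ]′
    (meets-three-disjoint⇒⊊I (I ℓ₁) (I ℓ₂) (I ℓ₃) (I zero)
      (apart ℓ₁ ℓ₂ (λ ()) (λ ())) (apart ℓ₂ ℓ₃ (λ ()) (λ ())) (apart ℓ₁ ℓ₃ (λ ()) (λ ()))
      (meets ℓ₁ (λ ()) _) (meets ℓ₂ (λ ()) _) (meets ℓ₃ (λ ()) _))
  where
  ℓ₁ ℓ₂ ℓ₃ : Fin 4
  ℓ₁ = suc zero
  ℓ₂ = suc (suc zero)
  ℓ₃ = suc (suc (suc zero))
  apart : ∀ u v → u ≢ v → ¬ Adj claw u v → ¬ Intersects (I u) (I v)
  apart u v u≢v ¬adj = ¬adj ∘ proj₂ (rep u v u≢v)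
  meets : ∀ u → zero ≢ u → Adj claw zero u → Intersects (I zero) (I u)
  meets u 0≢u = proj₁ (rep zero u 0≢u)

claw-intervals : Fin 4 → Interval
claw-intervals zero                   = [ + 1 , + 3 ]⟨ +≤+ (ℕ.s≤s ℕ.z≤n) ⟩
claw-intervals (suc zero)             = [ + 0 , + 1 ]⟨ +≤+ ℕ.z≤n ⟩
claw-intervals (suc (suc zero))       = [ + 2 , + 2 ]⟨ ≤-refl ⟩
claw-intervals (suc (suc (suc zero))) = [ + 3 , + 4 ]⟨ +≤+ (ℕ.s≤s (ℕ.s≤s (ℕ.s≤s ℕ.z≤n))) ⟩

claw-hitting-set : List ℤ
claw-hitting-set = + 0 ∷ + 2 ∷ + 4 ∷ []

claw-exactlyHittable : IsExactlyHittable claw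
claw-exactlyHittable =
  claw-intervals ,
  from-yes (isIntervalRep? claw (λ u v → T? _) claw-intervals) ,
  (_∈ claw-hitting-set) ,
  λ v → hitExactlyOnce-fromCount (claw-intervals v) claw-hitting-set (from-yes (all? counts-one) v)
  where
  counts-one : ∀ v → Dec (length (filter (_∈I? claw-intervals v) claw-hitting-set) ≡ 1)
  counts-one v = length (filter (_∈I? claw-intervals v) claw-hitting-set) ℕ.≟ 1

lemma7 : ((n : ℕ) (G : Graph n) → IsProperIntervalGraph G → IsExactlyHittable G)
    × (∃[ n ] ∃[ G ] (IsExactlyHittable {n} G × ¬ IsProperIntervalGraph G))
lemma7 = (λ _ → proper⇒exactlyHittable) , 4 , claw , claw-exactlyHittable , claw-not-proper
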